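{- Let $\ell$ be a positive integer. Then there is a unique half-full tree (haft) $T$ with $\ell$ leaves. Moreover, let $h$ be the number of ones in the binary representation of $\ell$, with indices $x_1>x_2>\dots>x_h$, so that $\ell=\sum_{i=1}^h 2^{x_i}$. Then either (a) $h=1$ and $T$ is a complete binary tree of depth $x_1$; or (b) $h\ge 2$ and $T$ consists of $h-1$ nodes $s_1,\dots,s_{h-1}$ together with $h$ complete binary trees $T_1,\dots,T_h$, where: $s_1$ is the root of $T$; each $T_i$ has depth $x_i$; each $s_i$ has the root of $T_i$ as its left child; for $1\le i\le h-2$, $s_i$ has $s_{i+1}$ as its right child; and $s_{h-1}$ has the root of $T_h$ as its right child.
   Context: A half-full tree (haft) is a rooted binary tree in which every non-leaf node $v$ has exactly two children, and the left child of $v$ is the root of a complete binary subtree (all leaves at the same depth, every internal node with two children) that contains at least half of $v$'s descendants. -}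

module Defs where

open import Data.Nat using (ℕ; zero; suc; _+_; _*_; _≤_)
open import Data.Product using (_×_; Σ)
open import Data.List using (List; []; _∷_)

data Tree : Set where
  leaf : Tree
  node : (l r : Tree) → Tree

size : Tree → ℕ
size leaf       = 1
size (node l r) = suc (size l + size r)

leaves : Tree → ℕ
leaves leaf       = 1
leaves (node l r) = leaves l + leaves r

descendants : Tree → ℕ
descendants leaf       = 0
descendants (node l r) = size l + size r

data Complete : ℕ → Tree → Set where
  leaf : Complete zero leaf
  node : ∀ {d l r} → Complete d l → Complete d r → Complete (suc d) (node l r)

IsComplete : Tree → Set
IsComplete t = Σ ℕ λ d → Complete d t

data Haft : Tree → Set where
  leaf : Haft leaf
  node : ∀ {l r} → IsComplete l → descendants (node l r) ≤ 2 * size l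
       → Haft l → Haft r → Haft (node l r)

-- Spine xs t, for xs = x₁ ∷ … ∷ x_h with h ≥ 1:
-- t = node T₁ (node T₂ (… (node T_{h-1} T_h))) where each Tᵢ is complete of depth xᵢ.
-- The node chain s₁ (root), …, s_{h-1} : sᵢ has the root of Tᵢ as left child,
-- sᵢ₊₁ as right child (i ≤ h-2), and s_{h-1} has the root of T_h as right child.
data Spine : List ℕ → Tree → Set where
  last : ∀ {x t} → Complete x t → Spine (x ∷ []) t
  cons : ∀ {x y xs l r} → Complete x l → Spine (y ∷ xs) r → Spine (x ∷ y ∷ xs) (node l r)

-- In a haft node l r the left subtree l is complete of some depth d and 1 ≤ leaves r ≤ 2^d,
-- so 2^d < leaves ≤ 2^(d+1). The number of leaves therefore determines d, hence l, hence
-- (inductively) r; existence is the same recursion read backwards. The spine built from the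
-- binary digits of ℓ is itself a haft, because each power of two exceeds the sum of the
-- smaller ones, so by uniqueness it is the haft with ℓ leaves.
module Submission where

open import Defs
open import Data.Nat using (ℕ; zero; suc; _+_; _*_; _∸_; _^_; _≤_; _<_; _>_; z≤n; s≤s; _≤?_)
open import Data.Nat.Properties
open import Data.List using (List; []; _∷_; map; length)
open import Data.Nat.ListAction using (sum)
open import Data.List.Relation.Unary.Linked using (Linked; _∷_)
open import Data.Product using (Σ; _×_; _,_; ∃!)
open import Data.Sum using (_⊎_; inj₁; inj₂)
open import Data.Empty using (⊥-elim)
open import Relation.Nullary using (yes; no)
open import Relation.Binary using (tri<; tri≈; tri>)
open import Relation.Binary.PropositionalEquality using (_≡_; refl; sym; trans; cong; cong₂; subst₂; module ≡-Reasoning)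

2^[1+n]≡2^n+2^n : ∀ n → 2 ^ suc n ≡ 2 ^ n + 2 ^ n
2^[1+n]≡2^n+2^n n = cong (2 ^ n +_) (+-identityʳ (2 ^ n))

n<2^n : ∀ n → n < 2 ^ n
n<2^n zero    = s≤s z≤n
n<2^n (suc n) = begin-strict
  suc n         ≤⟨ n<2^n n ⟩
  2 ^ n         <⟨ m<m+n (2 ^ n) (m^n>0 2 n) ⟩
  2 ^ n + 2 ^ n ≡⟨ 2^[1+n]≡2^n+2^n n ⟨
  2 ^ suc n     ∎
  where open ≤-Reasoning

2^-bracket-unique : ∀ d e {m} → 2 ^ d < m → m ≤ 2 ^ suc d → 2 ^ e < m → m ≤ 2 ^ suc e → d ≡ e
2^-bracket-unique d e 2^d<m m≤2^[1+d] 2^e<m m≤2^[1+e] with <-cmp d e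
... | tri< d<e _ _ = ⊥-elim (<-irrefl refl (<-≤-trans 2^e<m (≤-trans m≤2^[1+d] (^-monoʳ-≤ 2 d<e))))
... | tri≈ _ d≡e _ = d≡e
... | tri> _ _ e<d = ⊥-elim (<-irrefl refl (<-≤-trans 2^d<m (≤-trans m≤2^[1+e] (^-monoʳ-≤ 2 e<d))))

m≤2^[1+n]⇒m∸2^n≤2^n : ∀ m n → m ≤ 2 ^ suc n → m ∸ 2 ^ n ≤ 2 ^ n
m≤2^[1+n]⇒m∸2^n≤2^n m n m≤2^[1+n] = m≤n+o⇒m∸n≤o m (2 ^ n) (subst₂ _≤_ refl (2^[1+n]≡2^n+2^n n) m≤2^[1+n])

sum[2^xs]<2^x : ∀ {x xs} → Linked _>_ (x ∷ xs) → sum (map (2 ^_) xs) < 2 ^ x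
sum[2^xs]<2^x {x} {[]}     _            = m^n>0 2 x
sum[2^xs]<2^x {x} {y ∷ ys} (x>y ∷ decr) = begin-strict
  2 ^ y + sum (map (2 ^_) ys) <⟨ +-monoʳ-< (2 ^ y) (sum[2^xs]<2^x decr) ⟩
  2 ^ y + 2 ^ y               ≡⟨ 2^[1+n]≡2^n+2^n y ⟨
  2 ^ suc y                   ≤⟨ ^-monoʳ-≤ 2 x>y ⟩
  2 ^ x                       ∎
  where open ≤-Reasoning

leaves>0 : ∀ t → leaves t > 0
leaves>0 leaf       = s≤s z≤n
leaves>0 (node l r) = ≤-trans (leaves>0 l) (m≤m+n (leaves l) (leaves r))

1+size≡2*leaves : ∀ t → suc (size t) ≡ 2 * leaves t
1+size≡2*leaves leaf       = refl
1+size≡2*leaves (node l r) = begin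
  suc (suc (size l + size r))   ≡⟨ cong suc (+-suc (size l) (size r)) ⟨
  suc (size l) + suc (size r)   ≡⟨ cong₂ _+_ (1+size≡2*leaves l) (1+size≡2*leaves r) ⟩
  2 * leaves l + 2 * leaves r   ≡⟨ *-distribˡ-+ 2 (leaves l) (leaves r) ⟨
  2 * (leaves l + leaves r)     ∎
  where open ≡-Reasoning

size≤⇒leaves≤ : ∀ t u → size t ≤ size u → leaves t ≤ leaves u
size≤⇒leaves≤ t u p = *-cancelˡ-≤ 2 (subst₂ _≤_ (1+size≡2*leaves t) (1+size≡2*leaves u) (s≤s p))

leaves≤⇒size≤ : ∀ t u → leaves t ≤ leaves u → size t ≤ size u
leaves≤⇒size≤ t u p =
  ≤-pred (subst₂ _≤_ (sym (1+size≡2*leaves t)) (sym (1+size≡2*leaves u)) (*-monoʳ-≤ 2 p))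

balanced⇒leaves≤ : ∀ l r → descendants (node l r) ≤ 2 * size l → leaves r ≤ leaves l
balanced⇒leaves≤ l r p =
  size≤⇒leaves≤ r l (+-cancelˡ-≤ (size l) (size r) (size l) (subst₂ _≤_ refl (cong (size l +_) (+-identityʳ (size l))) p))

leaves≤⇒balanced : ∀ l r → leaves r ≤ leaves l → descendants (node l r) ≤ 2 * size l
leaves≤⇒balanced l r p =
  subst₂ _≤_ refl (cong (size l +_) (sym (+-identityʳ (size l)))) (+-monoʳ-≤ (size l) (leaves≤⇒size≤ r l p))

Complete⇒leaves≡2^ : ∀ {d t} → Complete d t → leaves t ≡ 2 ^ d
Complete⇒leaves≡2^ leaf                 = refl
Complete⇒leaves≡2^ {suc d} (node cl cr) =
  trans (cong₂ _+_ (Complete⇒leaves≡2^ cl) (Complete⇒leaves≡2^ cr)) (sym (2^[1+n]≡2^n+2^n d))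

Complete-unique : ∀ {d t u} → Complete d t → Complete d u → t ≡ u
Complete-unique leaf         leaf           = refl
Complete-unique (node cl cr) (node cl′ cr′) = cong₂ node (Complete-unique cl cl′) (Complete-unique cr cr′)

full : ℕ → Tree
full zero    = leaf
full (suc d) = node (full d) (full d)

full-Complete : ∀ d → Complete d (full d)
full-Complete zero    = leaf
full-Complete (suc d) = node (full-Complete d) (full-Complete d)

Complete⇒Haft : ∀ {d t} → Complete d t → Haft t
Complete⇒Haft leaf = leaf
Complete⇒Haft (node {d} {l} {r} cl cr) =
  node (d , cl) (leaves≤⇒balanced l r (≤-reflexive (trans (Complete⇒leaves≡2^ cr) (sym (Complete⇒leaves≡2^ cl)))))
       (Complete⇒Haft cl) (Complete⇒Haft cr)

haft-node : ∀ {d l r} → Complete d l → leaves r ≤ leaves l → Haft r → Haft (node l r)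
haft-node {d} {l} {r} cl r≤l hr = node (d , cl) (leaves≤⇒balanced l r r≤l) (Complete⇒Haft cl) hr

node-leaves-bracket : ∀ {d l} r → Complete d l → leaves r ≤ leaves l →
                      2 ^ d < leaves (node l r) × leaves (node l r) ≤ 2 ^ suc d
node-leaves-bracket {d} r cl r≤l rewrite Complete⇒leaves≡2^ cl =
  m<m+n (2 ^ d) (leaves>0 r) , subst₂ _≤_ refl (sym (2^[1+n]≡2^n+2^n d)) (+-monoʳ-≤ (2 ^ d) r≤l)

Haft-unique : ∀ {t u} → Haft t → Haft u → leaves t ≡ leaves u → t ≡ u
Haft-unique leaf leaf _ = refl
Haft-unique leaf (node {l} {r} _ _ _ _) eq = ⊥-elim (<-irrefl eq (+-mono-≤ (leaves>0 l) (leaves>0 r)))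
Haft-unique (node {l} {r} _ _ _ _) leaf eq = ⊥-elim (<-irrefl (sym eq) (+-mono-≤ (leaves>0 l) (leaves>0 r)))
Haft-unique (node {l} {r} (d , cl) bal _ hr) (node {l′} {r′} (e , cl′) bal′ _ hr′) eq
  with node-leaves-bracket r cl (balanced⇒leaves≤ l r bal) | node-leaves-bracket r′ cl′ (balanced⇒leaves≤ l′ r′ bal′)
... | lo , hi | lo′ , hi′ with 2^-bracket-unique d e lo hi (subst₂ _<_ refl (sym eq) lo′) (subst₂ _≤_ (sym eq) refl hi′)
... | refl with Complete-unique cl cl′
... | refl = cong (node l) (Haft-unique hr hr′ (+-cancelˡ-≡ (leaves l) _ _ eq))

Haft-exists : ∀ d {m} → 1 ≤ m → m ≤ 2 ^ d → Σ Tree λ t → Haft t × leaves t ≡ m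
Haft-exists zero (s≤s z≤n) (s≤s z≤n) = leaf , leaf , refl
Haft-exists (suc d) {m} 1≤m m≤2^[1+d] with m ≤? 2 ^ d
... | yes m≤2^d = Haft-exists d 1≤m m≤2^d
... | no m≰2^d with Haft-exists d (m<n⇒0<n∸m (≰⇒> m≰2^d)) (m≤2^[1+n]⇒m∸2^n≤2^n m d m≤2^[1+d])
... | r , hr , leaves-r =
  node (full d) r ,
  haft-node (full-Complete d) (subst₂ _≤_ (sym leaves-r) (sym leaves-full) (m≤2^[1+n]⇒m∸2^n≤2^n m d m≤2^[1+d])) hr ,
  trans (cong₂ _+_ leaves-full leaves-r) (m+[n∸m]≡n (<⇒≤ (≰⇒> m≰2^d)))
  where
  leaves-full : leaves (full d) ≡ 2 ^ d
  leaves-full = Complete⇒leaves≡2^ (full-Complete d)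

Spine⇒leaves≡sum : ∀ {xs t} → Spine xs t → leaves t ≡ sum (map (2 ^_) xs)
Spine⇒leaves≡sum (last {x} c) = trans (Complete⇒leaves≡2^ c) (sym (+-identityʳ (2 ^ x)))
Spine⇒leaves≡sum (cons c s)   = cong₂ _+_ (Complete⇒leaves≡2^ c) (Spine⇒leaves≡sum s)

Spine⇒Haft : ∀ {xs t} → Linked _>_ xs → Spine xs t → Haft t
Spine⇒Haft _                (last c)   = Complete⇒Haft c
Spine⇒Haft decr@(_ ∷ decr′) (cons c s) =
  haft-node c (subst₂ _≤_ (sym (Spine⇒leaves≡sum s)) (sym (Complete⇒leaves≡2^ c)) (<⇒≤ (sum[2^xs]<2^x decr)))
              (Spine⇒Haft decr′ s)

Spine-exists : ∀ x xs → Σ Tree (Spine (x ∷ xs))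
Spine-exists x []       = full x , last (full-Complete x)
Spine-exists x (y ∷ ys) with Spine-exists y ys
... | r , s = node (full x) r , cons (full-Complete x) s

Haft⇒Spine : ∀ {xs t} → Linked _>_ xs → Haft t → leaves t ≡ sum (map (2 ^_) xs) → Spine xs t
Haft⇒Spine {[]} {t} _ _ eq = ⊥-elim (<-irrefl (sym eq) (leaves>0 t))
Haft⇒Spine {x ∷ xs} decr ht eq with Spine-exists x xs
... | _ , s with Haft-unique ht (Spine⇒Haft decr s) (trans eq (sym (Spine⇒leaves≡sum s)))
... | refl = s

Spine-shape : ∀ {xs t} → Spine xs t →
              Σ ℕ (λ x → xs ≡ x ∷ [] × Complete x t) ⊎ (2 ≤ length xs × Spine xs t)
Spine-shape (last c)     = inj₁ (_ , refl , c)
Spine-shape s@(cons _ _) = inj₂ (s≤s (s≤s z≤n) , s)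

lemma4p1 : (ℓ : ℕ) → 1 ≤ ℓ →
    ∃! _≡_ (λ T → Haft T × leaves T ≡ ℓ)
    × ((xs : List ℕ) → Linked _>_ xs → sum (map (2 ^_) xs) ≡ ℓ →
       (T : Tree) → Haft T → leaves T ≡ ℓ →
       (Σ ℕ (λ x → xs ≡ x ∷ [] × Complete x T))
       ⊎ (2 ≤ length xs × Spine xs T))
lemma4p1 ℓ 1≤ℓ with Haft-exists ℓ 1≤ℓ (<⇒≤ (n<2^n ℓ))
... | T , hT , leaves-T =
  (T , (hT , leaves-T) , λ (hU , leaves-U) → Haft-unique hT hU (trans leaves-T (sym leaves-U))) ,
  λ xs decr sum≡ℓ U hU leaves-U → Spine-shape (Haft⇒Spine decr hU (trans leaves-U (sym sum≡ℓ)))
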